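{- Let $t\ge1$ and $n\ge1$, and let $w_i^{(t)}$ denote the number of $t$-tuples of permutations in $\mathfrak{S}_i$ with no common ascent (with $w_0^{(t)}=1$). Then for $1\le k\le n$, the alternating sum \[\sum_{i=0}^k(-1)^{k-i}\,w_i^{(t)}\binom{n}{i}^t\] is a nonnegative integer.
   Context: An ascent of $\sigma\in\mathfrak{S}_i$ is an index $j\in[i-1]$ with $\sigma(j)<\sigma(j+1)$; a $t$-tuple of permutations has no common ascent if no index is an ascent of all of them. -}

module Defs where

open import Data.Nat as ℕ using (ℕ; zero; suc)
open import Data.Nat.Combinatorics using (_C_)
open import Data.Integer as ℤ using (ℤ; +_; -_)
open import Data.Fin as Fin using (Fin; inject₁)
open import Data.Fin.Properties using (all?; any?; _≟_)
import Data.Fin.Properties as FinP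
open import Data.Vec as Vec using (Vec; []; _∷_; lookup)
open import Data.Vec.Relation.Unary.All as VAll using (All)
open import Data.List as List using (List; length; filter; allFin)
open import Data.Product using (∃)
open import Relation.Binary.PropositionalEquality using (_≡_)
open import Relation.Nullary using (¬_; ¬?)
open import Relation.Nullary.Decidable using (Dec; _→-dec_)
open import Relation.Unary using (Decidable)

vecsFrom : ∀ {a} {A : Set a} → List A → (m : ℕ) → List (Vec A m)
vecsFrom xs zero    = [] List.∷ List.[]
vecsFrom xs (suc m) = List.cartesianProductWith _∷_ xs (vecsFrom xs m)

-- A permutation of [i] in one-line notation: σ(1) … σ(i), stored as a vector
-- of length i with entries in Fin i, required to be injective.
IsPerm : ∀ {i} → Vec (Fin i) i → Set
IsPerm {i} σ = ∀ (a b : Fin i) → lookup σ a ≡ lookup σ b → a ≡ b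

isPerm? : ∀ {i} → Decidable (IsPerm {i})
isPerm? σ = all? λ a → all? λ b → (lookup σ a ≟ lookup σ b) →-dec (a ≟ b)

perms : (i : ℕ) → List (Vec (Fin i) i)
perms i = filter isPerm? (vecsFrom (allFin i) i)

-- Index j ∈ [i-1] (0-based: positions j, j+1 of a vector of length i = suc m)
-- is an ascent of σ iff σ(j) < σ(j+1).
IsAscent : ∀ {m} → Vec (Fin (suc m)) (suc m) → Fin m → Set
IsAscent σ j = lookup σ (inject₁ j) Fin.< lookup σ (Fin.suc j)

isAscent? : ∀ {m} (σ : Vec (Fin (suc m)) (suc m)) → Decidable (IsAscent σ)
isAscent? σ j = lookup σ (inject₁ j) FinP.<? lookup σ (Fin.suc j)

NoCommonAscent : ∀ {i t} → Vec (Vec (Fin i) i) t → Set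
NoCommonAscent {zero}  τ = ¬ (∃ λ (j : Fin 0) → j ≡ j)  -- [i-1] is empty
NoCommonAscent {suc m} τ = ¬ (∃ λ (j : Fin m) → All (λ σ → IsAscent σ j) τ)

noCommonAscent? : ∀ {i t} → Decidable (NoCommonAscent {i} {t})
noCommonAscent? {zero}  τ = ¬? (any? λ ())
noCommonAscent? {suc m} τ = ¬? (any? λ j → VAll.all? (λ σ → isAscent? σ j) τ)

w : (t i : ℕ) → ℕ
w t zero    = 1
w t (suc m) = length (filter noCommonAscent? (vecsFrom (perms (suc m)) t))

sign : ℕ → ℤ
sign zero    = + 1
sign (suc e) = - sign e

altSum : (t n k : ℕ) → ℤ
altSum t n k = go k
  where
  go : ℕ → ℤ
  go zero    = sign k ℤ.* (+ (w t 0 ℕ.* (n C 0) ℕ.^ t))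
  go (suc i) = go i ℤ.+ sign (k ℕ.∸ suc i) ℤ.* (+ (w t (suc i) ℕ.* (n C suc i) ℕ.^ t))

{-# OPTIONS --safe #-}
-- For m < n let E m count the t-tuples of permutations of {0,…,m} with no
-- common ascent, each permutation σ weighted by C(n−m−1+σ(0), n−m−1).
-- A permutation of {0,…,m+1} is a first letter v followed by a standardised
-- permutation σ of {0,…,m}: position 0 is an ascent iff v ≤ σ(0), and the other
-- ascents are those of σ.  By the hockey-stick identity the weights of all first
-- letters v sum to C(n,m+1), and those of the v ≤ σ(0) to the weight of σ.  So
-- the extensions of a tuple without common ascent that have no common ascent
-- weigh C(n,m+1)^t minus the weight of the tuple: E (m+1) + E m = w_{m+1} C(n,m+1)^t
-- for m+2 ≤ n.  As E 0 = 1, the alternating sum is E k ≥ 0 for k < n, and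
-- w_n − E (n−1) = 0 for k = n, where all weights are 1.
module Submission where

import Algebra.Properties.CommutativeSemigroup as CommSemigroupProperties
open import Data.Bool using (true; false; if_then_else_)
open import Data.Fin as Fin using (Fin; zero; suc; punchIn; toℕ)
open import Data.Fin.Properties as Fin using (_≟_)
open import Data.Integer as ℤ using (ℤ)
import Data.Integer.Properties as ℤ
open import Data.List as List
  using (List; []; _∷_; _++_; allFin; filter; length; cartesianProductWith)
import Data.List.Properties as List
open import Data.Nat using (ℕ; zero; suc; _+_; _*_; _∸_; _^_; _≤_; _<_; z≤n; s≤s; s≤s⁻¹)
open import Data.Nat.Combinatorics
  using (_C_; nCk+nC[k+1]≡[n+1]C[k+1]; k>n⇒nCk≡0; nCk≡nC[n∸k]; nCn≡1)
open import Data.Nat.Properties as ℕ using (+-commutativeSemigroup; *-commutativeSemigroup)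
open import Data.Product using (_×_; _,_)
open import Data.Sum using (inj₁; inj₂)
open import Data.Vec as Vec using (Vec; []; _∷_; zipWith)
open import Data.Vec.Properties using (lookup-map)
open import Data.Vec.Relation.Unary.All using (All; []; _∷_; all?)
open import Data.Vec.Relation.Unary.All.Properties using (lookup⁺; lookup⁻)
open import Function using (_⇔_; mk⇔; Equivalence; _∘_; id)
open import Relation.Binary.PropositionalEquality
open import Relation.Nullary using (Dec; yes; no; does; ¬_; ¬?; _×-dec_; _→-dec_; contradiction)
open import Relation.Unary using (Decidable)

open import Defs
  using (vecsFrom; perms; IsAscent; isAscent?; NoCommonAscent; noCommonAscent?; w; sign; altSum)

open ≡-Reasoning
open import Algebra.Properties.AbelianGroup ℤ.+-0-abelianGroup using (//-rightDividesʳ)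
module +-CS = CommSemigroupProperties +-commutativeSemigroup
module *-CS = CommSemigroupProperties *-commutativeSemigroup

private variable
  X Y Z : Set
  k m t : ℕ

-- Finite sums and products

-- The body of ∑[ x ∈ xs ] … extends over _*_ and _C_ but not over _+_.
infix 6.4 ∑ ∏

∑ : List X → (X → ℕ) → ℕ
∑ []       f = 0
∑ (x ∷ xs) f = f x + ∑ xs f

syntax ∑ xs (λ x → e) = ∑[ x ∈ xs ] e

∏ : Vec X t → (X → ℕ) → ℕ
∏ []       f = 1
∏ (x ∷ xs) f = f x * ∏ xs f

syntax ∏ xs (λ x → e) = ∏[ x ∈ xs ] e

∑-cong : (xs : List X) {f g : X → ℕ} → (∀ x → f x ≡ g x) → ∑ xs f ≡ ∑ xs g
∑-cong []       f≗g = refl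
∑-cong (x ∷ xs) f≗g = cong₂ _+_ (f≗g x) (∑-cong xs f≗g)

∑-0 : (xs : List X) → ∑[ x ∈ xs ] 0 ≡ 0
∑-0 []       = refl
∑-0 (x ∷ xs) = ∑-0 xs

∑-++ : (xs ys : List X) (f : X → ℕ) → ∑ (xs ++ ys) f ≡ ∑ xs f + ∑ ys f
∑-++ []       ys f = refl
∑-++ (x ∷ xs) ys f = trans (cong (f x +_) (∑-++ xs ys f)) (sym (ℕ.+-assoc (f x) _ _))

∑-map : (g : X → Y) (xs : List X) (f : Y → ℕ) → ∑ (List.map g xs) f ≡ ∑[ x ∈ xs ] f (g x)
∑-map g []       f = refl
∑-map g (x ∷ xs) f = cong (f (g x) +_) (∑-map g xs f)

∑-cartesianProductWith : (g : X → Y → Z) (xs : List X) (ys : List Y) (f : Z → ℕ) →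
  ∑ (cartesianProductWith g xs ys) f ≡ ∑[ x ∈ xs ] ∑[ y ∈ ys ] f (g x y)
∑-cartesianProductWith g []       ys f = refl
∑-cartesianProductWith g (x ∷ xs) ys f = begin
  ∑ (List.map (g x) ys ++ cartesianProductWith g xs ys) f
    ≡⟨ ∑-++ (List.map (g x) ys) _ f ⟩
  ∑ (List.map (g x) ys) f + ∑ (cartesianProductWith g xs ys) f
    ≡⟨ cong₂ _+_ (∑-map (g x) ys f) (∑-cartesianProductWith g xs ys f) ⟩
  ∑[ y ∈ ys ] f (g x y) + ∑[ x′ ∈ xs ] ∑[ y ∈ ys ] f (g x′ y) ∎

∑-distrib-+ : (xs : List X) (f g : X → ℕ) → ∑[ x ∈ xs ] (f x + g x) ≡ ∑ xs f + ∑ xs g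
∑-distrib-+ []       f g = refl
∑-distrib-+ (x ∷ xs) f g =
  trans (cong (f x + g x +_) (∑-distrib-+ xs f g)) (+-CS.interchange (f x) (g x) _ _)

∑-comm : (xs : List X) (ys : List Y) (f : X → Y → ℕ) →
  ∑[ x ∈ xs ] ∑[ y ∈ ys ] f x y ≡ ∑[ y ∈ ys ] ∑[ x ∈ xs ] f x y
∑-comm []       ys f = sym (∑-0 ys)
∑-comm (x ∷ xs) ys f = begin
  ∑[ y ∈ ys ] f x y + ∑[ x′ ∈ xs ] ∑[ y ∈ ys ] f x′ y
    ≡⟨ cong (∑[ y ∈ ys ] f x y +_) (∑-comm xs ys f) ⟩
  ∑[ y ∈ ys ] f x y + ∑[ y ∈ ys ] ∑[ x′ ∈ xs ] f x′ y
    ≡⟨ ∑-distrib-+ ys (f x) _ ⟨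
  ∑[ y ∈ ys ] (f x y + ∑[ x′ ∈ xs ] f x′ y) ∎

*-distribˡ-∑ : (c : ℕ) (xs : List X) (f : X → ℕ) →
  c * (∑[ x ∈ xs ] f x) ≡ ∑[ x ∈ xs ] c * f x
*-distribˡ-∑ c []       f = ℕ.*-zeroʳ c
*-distribˡ-∑ c (x ∷ xs) f =
  trans (ℕ.*-distribˡ-+ c (f x) _) (cong (c * f x +_) (*-distribˡ-∑ c xs f))

*-distribʳ-∑ : (c : ℕ) (xs : List X) (f : X → ℕ) →
  (∑[ x ∈ xs ] f x) * c ≡ ∑[ x ∈ xs ] f x * c
*-distribʳ-∑ c []       f = refl
*-distribʳ-∑ c (x ∷ xs) f =
  trans (ℕ.*-distribʳ-+ c (f x) _) (cong (f x * c +_) (*-distribʳ-∑ c xs f))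

∑-allFin-suc : (k : ℕ) (f : Fin (suc k) → ℕ) →
  ∑ (allFin (suc k)) f ≡ f zero + ∑[ i ∈ allFin k ] f (suc i)
∑-allFin-suc k f = cong (f zero +_) (begin
  ∑ (List.tabulate suc) f          ≡⟨ cong (λ is → ∑ is f) (List.map-tabulate id suc) ⟨
  ∑ (List.map suc (allFin k)) f    ≡⟨ ∑-map suc (allFin k) f ⟩
  ∑[ i ∈ allFin k ] f (suc i)      ∎)

∏-cong : (xs : Vec X t) {f g : X → ℕ} → (∀ x → f x ≡ g x) → ∏ xs f ≡ ∏ xs g
∏-cong []       f≗g = refl
∏-cong (x ∷ xs) f≗g = cong₂ _*_ (f≗g x) (∏-cong xs f≗g)

∏-const : (xs : Vec X t) (c : ℕ) → ∏[ x ∈ xs ] c ≡ c ^ t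
∏-const []       c = refl
∏-const (x ∷ xs) c = cong (c *_) (∏-const xs c)

-- Defined through `does`, so that the indicator of a decision built with `map′`
-- (such as `all?` on a cons) reduces to that of the underlying decision.
𝟙 : {P : Set} → Dec P → ℕ
𝟙 p? = if does p? then 1 else 0

𝟙-⇔ : {P Q : Set} → P ⇔ Q → (p? : Dec P) (q? : Dec Q) → 𝟙 p? ≡ 𝟙 q?
𝟙-⇔ P⇔Q (yes p) (yes q) = refl
𝟙-⇔ P⇔Q (yes p) (no ¬q) = contradiction (Equivalence.to P⇔Q p) ¬q
𝟙-⇔ P⇔Q (no ¬p) (yes q) = contradiction (Equivalence.from P⇔Q q) ¬p
𝟙-⇔ P⇔Q (no ¬p) (no ¬q) = refl

𝟙-yes : {P : Set} → P → (p? : Dec P) → 𝟙 p? ≡ 1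
𝟙-yes p (yes _) = refl
𝟙-yes p (no ¬p) = contradiction p ¬p

𝟙-×-dec : {P Q : Set} (p? : Dec P) (q? : Dec Q) → 𝟙 (p? ×-dec q?) ≡ 𝟙 p? * 𝟙 q?
𝟙-×-dec (yes _) (yes _) = refl
𝟙-×-dec (yes _) (no _)  = refl
𝟙-×-dec (no _)  _       = refl

𝟙-¬?+𝟙 : {P : Set} (p? : Dec P) (x : ℕ) → 𝟙 (¬? p?) * x + 𝟙 p? * x ≡ x
𝟙-¬?+𝟙 (yes _) x = ℕ.+-identityʳ x
𝟙-¬?+𝟙 (no _)  x = trans (ℕ.+-identityʳ (x + 0)) (ℕ.+-identityʳ x)

∑-filter : {P : X → Set} (P? : Decidable P) (xs : List X) (f : X → ℕ) →
  ∑ (filter P? xs) f ≡ ∑[ x ∈ xs ] 𝟙 (P? x) * f x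
∑-filter P? []       f = refl
∑-filter P? (x ∷ xs) f with does (P? x)
... | true  = cong₂ _+_ (sym (ℕ.+-identityʳ (f x))) (∑-filter P? xs f)
... | false = ∑-filter P? xs f

length-filter : {P : X → Set} (P? : Decidable P) (xs : List X) →
  length (filter P? xs) ≡ ∑[ x ∈ xs ] 𝟙 (P? x)
length-filter P? []       = refl
length-filter P? (x ∷ xs) with does (P? x)
... | true  = cong suc (length-filter P? xs)
... | false = length-filter P? xs

𝟙-all?*∏ : {P : X → Set} (P? : Decidable P) (zs : Vec X t) (f : X → ℕ) →
  𝟙 (all? P? zs) * (∏[ z ∈ zs ] f z) ≡ ∏[ z ∈ zs ] 𝟙 (P? z) * f z
𝟙-all?*∏ P? []       f = refl
𝟙-all?*∏ P? (z ∷ zs) f = begin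
  𝟙 (P? z ×-dec all? P? zs) * (f z * ∏ zs f)
    ≡⟨ cong (_* (f z * ∏ zs f)) (𝟙-×-dec (P? z) (all? P? zs)) ⟩
  𝟙 (P? z) * 𝟙 (all? P? zs) * (f z * ∏ zs f)
    ≡⟨ *-CS.interchange (𝟙 (P? z)) _ (f z) _ ⟩
  𝟙 (P? z) * f z * (𝟙 (all? P? zs) * ∏ zs f)
    ≡⟨ cong (𝟙 (P? z) * f z *_) (𝟙-all?*∏ P? zs f) ⟩
  𝟙 (P? z) * f z * (∏[ z′ ∈ zs ] 𝟙 (P? z′) * f z′) ∎

∑-vecsFrom-suc : (xs : List X) (t : ℕ) (f : Vec X (suc t) → ℕ) →
  ∑ (vecsFrom xs (suc t)) f ≡ ∑[ x ∈ xs ] ∑[ u ∈ vecsFrom xs t ] f (x ∷ u)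
∑-vecsFrom-suc xs t f = ∑-cartesianProductWith _∷_ xs (vecsFrom xs t) f

∑-vecsFrom-singleton : (x : X) (t : ℕ) (f : Vec X t → ℕ) →
  ∑ (vecsFrom (x ∷ []) t) f ≡ f (Vec.replicate t x)
∑-vecsFrom-singleton x zero    f = ℕ.+-identityʳ (f [])
∑-vecsFrom-singleton x (suc t) f = begin
  ∑ (vecsFrom (x ∷ []) (suc t)) f                     ≡⟨ ∑-vecsFrom-suc (x ∷ []) t f ⟩
  ∑[ u ∈ vecsFrom (x ∷ []) t ] f (x ∷ u) + 0          ≡⟨ ℕ.+-identityʳ _ ⟩
  ∑[ u ∈ vecsFrom (x ∷ []) t ] f (x ∷ u)              ≡⟨ ∑-vecsFrom-singleton x t (f ∘ (x ∷_)) ⟩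
  f (Vec.replicate (suc t) x)                         ∎

∑-vecsFrom-∏ : (g : X → Y → Z) (xs : List X) (ys : Vec Y t) (f : Z → ℕ) →
  ∑[ vs ∈ vecsFrom xs t ] ∏[ z ∈ zipWith g vs ys ] f z ≡ ∏[ y ∈ ys ] ∑[ x ∈ xs ] f (g x y)
∑-vecsFrom-∏ g xs []       f = refl
∑-vecsFrom-∏ {t = suc t} g xs (y ∷ ys) f = begin
  ∑[ vs ∈ vecsFrom xs (suc t) ] ∏[ z ∈ zipWith g vs (y ∷ ys) ] f z
    ≡⟨ ∑-vecsFrom-suc xs t _ ⟩
  ∑[ x ∈ xs ] ∑[ u ∈ vecsFrom xs t ] f (g x y) * (∏[ z ∈ zipWith g u ys ] f z)
    ≡⟨ ∑-cong xs (λ x → *-distribˡ-∑ (f (g x y)) (vecsFrom xs t) _) ⟨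
  ∑[ x ∈ xs ] f (g x y) * (∑[ u ∈ vecsFrom xs t ] ∏[ z ∈ zipWith g u ys ] f z)
    ≡⟨ ∑-cong xs (λ x → cong (f (g x y) *_) (∑-vecsFrom-∏ g xs ys f)) ⟩
  ∑[ x ∈ xs ] f (g x y) * (∏[ y′ ∈ ys ] ∑[ x′ ∈ xs ] f (g x′ y′))
    ≡⟨ *-distribʳ-∑ _ xs _ ⟨
  (∑[ x ∈ xs ] f (g x y)) * (∏[ y′ ∈ ys ] ∑[ x′ ∈ xs ] f (g x′ y′)) ∎

∑-vecsFrom-zipWith : (g : X → Y → Z) (xs : List X) (ys : List Y) (zs : List Z) →
  (∀ f → ∑ zs f ≡ ∑[ y ∈ ys ] ∑[ x ∈ xs ] f (g x y)) →
  ∀ t (f : Vec Z t → ℕ) →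
  ∑ (vecsFrom zs t) f ≡ ∑[ τ ∈ vecsFrom ys t ] ∑[ vs ∈ vecsFrom xs t ] f (zipWith g vs τ)
∑-vecsFrom-zipWith g xs ys zs split zero    f = sym (ℕ.+-identityʳ (f [] + 0))
∑-vecsFrom-zipWith g xs ys zs split (suc t) f = begin
  ∑ (vecsFrom zs (suc t)) f
    ≡⟨ ∑-vecsFrom-suc zs t f ⟩
  ∑[ z ∈ zs ] ∑[ u ∈ vecsFrom zs t ] f (z ∷ u)
    ≡⟨ ∑-cong zs (λ z → ∑-vecsFrom-zipWith g xs ys zs split t (f ∘ (z ∷_))) ⟩
  ∑[ z ∈ zs ] ∑[ τ ∈ vecsFrom ys t ] ∑[ vs ∈ vecsFrom xs t ] f (z ∷ zipWith g vs τ)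
    ≡⟨ split _ ⟩
  ∑[ y ∈ ys ] ∑[ x ∈ xs ] ∑[ τ ∈ vecsFrom ys t ] ∑[ vs ∈ vecsFrom xs t ] f (g x y ∷ zipWith g vs τ)
    ≡⟨ ∑-cong ys (λ y → ∑-comm xs (vecsFrom ys t) _) ⟩
  ∑[ y ∈ ys ] ∑[ τ ∈ vecsFrom ys t ] ∑[ x ∈ xs ] ∑[ vs ∈ vecsFrom xs t ] f (g x y ∷ zipWith g vs τ)
    ≡⟨ ∑-cong ys (λ y → ∑-cong (vecsFrom ys t) (λ τ → ∑-vecsFrom-suc xs t _)) ⟨
  ∑[ y ∈ ys ] ∑[ τ ∈ vecsFrom ys t ] ∑[ vs ∈ vecsFrom xs (suc t) ] f (zipWith g vs (y ∷ τ))
    ≡⟨ ∑-vecsFrom-suc ys t _ ⟨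
  ∑[ τ ∈ vecsFrom ys (suc t) ] ∑[ vs ∈ vecsFrom xs (suc t) ] f (zipWith g vs τ) ∎

-- Permutations by their first letter

∑-allFin-punchIn : (v : Fin (suc k)) (f : Fin (suc k) → ℕ) →
  ∑[ x ∈ allFin (suc k) ] 𝟙 (¬? (x ≟ v)) * f x ≡ ∑[ y ∈ allFin k ] f (punchIn v y)
∑-allFin-punchIn {k} zero f = begin
  ∑[ x ∈ allFin (suc k) ] 𝟙 (¬? (x ≟ zero)) * f x
    ≡⟨ ∑-allFin-suc k (λ x → 𝟙 (¬? (x ≟ zero)) * f x) ⟩
  ∑[ y ∈ allFin k ] 1 * f (suc y)
    ≡⟨ ∑-cong (allFin k) (λ y → ℕ.*-identityˡ (f (suc y))) ⟩
  ∑[ y ∈ allFin k ] f (suc y) ∎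
∑-allFin-punchIn {suc k} (suc v) f = begin
  ∑[ x ∈ allFin (suc (suc k)) ] 𝟙 (¬? (x ≟ suc v)) * f x
    ≡⟨ ∑-allFin-suc (suc k) (λ x → 𝟙 (¬? (x ≟ suc v)) * f x) ⟩
  1 * f zero + ∑[ x ∈ allFin (suc k) ] 𝟙 (¬? (x ≟ v)) * f (suc x)
    ≡⟨ cong₂ _+_ (ℕ.*-identityˡ (f zero)) (∑-allFin-punchIn v (f ∘ suc)) ⟩
  f zero + ∑[ y ∈ allFin k ] f (suc (punchIn v y))
    ≡⟨ ∑-allFin-suc k (f ∘ punchIn (suc v)) ⟨
  ∑[ y ∈ allFin (suc k) ] f (punchIn (suc v) y) ∎

Avoids : Fin k → Vec (Fin k) m → Set
Avoids v = All (_≢ v)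

avoids? : (v : Fin k) (u : Vec (Fin k) m) → Dec (Avoids v u)
avoids? v = all? (λ x → ¬? (x ≟ v))

∑-vecsFrom-avoiding : (v : Fin (suc k)) (m : ℕ) (f : Vec (Fin (suc k)) m → ℕ) →
  ∑[ u ∈ vecsFrom (allFin (suc k)) m ] 𝟙 (avoids? v u) * f u
    ≡ ∑[ σ ∈ vecsFrom (allFin k) m ] f (Vec.map (punchIn v) σ)
∑-vecsFrom-avoiding v zero    f = cong (_+ 0) (ℕ.*-identityˡ (f []))
∑-vecsFrom-avoiding {k} v (suc m) f = begin
  ∑[ u ∈ vecsFrom letters (suc m) ] 𝟙 (avoids? v u) * f u
    ≡⟨ ∑-vecsFrom-suc letters m _ ⟩
  ∑[ x ∈ letters ] ∑[ u ∈ vecsFrom letters m ] 𝟙 (¬? (x ≟ v) ×-dec avoids? v u) * f (x ∷ u)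
    ≡⟨ ∑-cong letters (λ x → ∑-cong (vecsFrom letters m) (λ u → split x u)) ⟩
  ∑[ x ∈ letters ] ∑[ u ∈ vecsFrom letters m ] 𝟙 (¬? (x ≟ v)) * (𝟙 (avoids? v u) * f (x ∷ u))
    ≡⟨ ∑-cong letters (λ x → *-distribˡ-∑ (𝟙 (¬? (x ≟ v))) (vecsFrom letters m) _) ⟨
  ∑[ x ∈ letters ] 𝟙 (¬? (x ≟ v)) * (∑[ u ∈ vecsFrom letters m ] 𝟙 (avoids? v u) * f (x ∷ u))
    ≡⟨ ∑-allFin-punchIn v _ ⟩
  ∑[ y ∈ allFin k ] ∑[ u ∈ vecsFrom letters m ] 𝟙 (avoids? v u) * f (punchIn v y ∷ u)
    ≡⟨ ∑-cong (allFin k) (λ y → ∑-vecsFrom-avoiding v m (f ∘ (punchIn v y ∷_))) ⟩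
  ∑[ y ∈ allFin k ] ∑[ σ ∈ vecsFrom (allFin k) m ] f (punchIn v y ∷ Vec.map (punchIn v) σ)
    ≡⟨ ∑-vecsFrom-suc (allFin k) m _ ⟨
  ∑[ σ ∈ vecsFrom (allFin k) (suc m) ] f (Vec.map (punchIn v) σ) ∎
  where
  letters : List (Fin (suc k))
  letters = allFin (suc k)
  split : ∀ x u → 𝟙 (¬? (x ≟ v) ×-dec avoids? v u) * f (x ∷ u)
                ≡ 𝟙 (¬? (x ≟ v)) * (𝟙 (avoids? v u) * f (x ∷ u))
  split x u = trans (cong (_* f (x ∷ u)) (𝟙-×-dec (¬? (x ≟ v)) (avoids? v u)))
                    (ℕ.*-assoc (𝟙 (¬? (x ≟ v))) (𝟙 (avoids? v u)) (f (x ∷ u)))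

-- `IsPerm` and `isPerm?` of Defs are the instances m = k of these, definitionally.
IsInjective : Vec (Fin k) m → Set
IsInjective u = ∀ a b → Vec.lookup u a ≡ Vec.lookup u b → a ≡ b

isInjective? : (u : Vec (Fin k) m) → Dec (IsInjective u)
isInjective? u = Fin.all? λ a → Fin.all? λ b → (Vec.lookup u a ≟ Vec.lookup u b) →-dec (a ≟ b)

isInjective-∷⇔ : (v : Fin k) (u : Vec (Fin k) m) →
  IsInjective (v ∷ u) ⇔ (Avoids v u × IsInjective u)
isInjective-∷⇔ v u = mk⇔ to from
  where
  to : IsInjective (v ∷ u) → Avoids v u × IsInjective u
  to inj = lookup⁻ (λ i eq → Fin.0≢1+n (sym (inj (suc i) zero eq)))
         , λ a b eq → Fin.suc-injective (inj (suc a) (suc b) eq)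
  from : Avoids v u × IsInjective u → IsInjective (v ∷ u)
  from (avoids , inj) zero    zero    eq = refl
  from (avoids , inj) zero    (suc b) eq = contradiction (sym eq) (lookup⁺ avoids b)
  from (avoids , inj) (suc a) zero    eq = contradiction eq (lookup⁺ avoids a)
  from (avoids , inj) (suc a) (suc b) eq = cong suc (inj a b eq)

isInjective-map-punchIn⇔ : (v : Fin (suc k)) (σ : Vec (Fin k) m) →
  IsInjective (Vec.map (punchIn v) σ) ⇔ IsInjective σ
isInjective-map-punchIn⇔ v σ = mk⇔
  (λ inj a b eq → inj a b (begin
    Vec.lookup (Vec.map (punchIn v) σ) a ≡⟨ lookup-map a (punchIn v) σ ⟩
    punchIn v (Vec.lookup σ a)           ≡⟨ cong (punchIn v) eq ⟩
    punchIn v (Vec.lookup σ b)           ≡⟨ lookup-map b (punchIn v) σ ⟨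
    Vec.lookup (Vec.map (punchIn v) σ) b ∎))
  (λ inj a b eq → inj a b (Fin.punchIn-injective v _ _ (begin
    punchIn v (Vec.lookup σ a)           ≡⟨ lookup-map a (punchIn v) σ ⟨
    Vec.lookup (Vec.map (punchIn v) σ) a ≡⟨ eq ⟩
    Vec.lookup (Vec.map (punchIn v) σ) b ≡⟨ lookup-map b (punchIn v) σ ⟩
    punchIn v (Vec.lookup σ b)           ∎)))

extend : Fin (suc k) → Vec (Fin k) m → Vec (Fin (suc k)) (suc m)
extend v σ = v ∷ Vec.map (punchIn v) σ

∑-injective-suc : (f : Vec (Fin (suc k)) (suc m) → ℕ) →
  ∑[ u ∈ vecsFrom (allFin (suc k)) (suc m) ] 𝟙 (isInjective? u) * f u
    ≡ ∑[ v ∈ allFin (suc k) ] ∑[ σ ∈ vecsFrom (allFin k) m ] 𝟙 (isInjective? σ) * f (extend v σ)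
∑-injective-suc {k} {m} f = begin
  ∑[ u ∈ vecsFrom letters (suc m) ] 𝟙 (isInjective? u) * f u
    ≡⟨ ∑-vecsFrom-suc letters m _ ⟩
  ∑[ v ∈ letters ] ∑[ u ∈ vecsFrom letters m ] 𝟙 (isInjective? (v ∷ u)) * f (v ∷ u)
    ≡⟨ ∑-cong letters (λ v → ∑-cong (vecsFrom letters m) (split v)) ⟩
  ∑[ v ∈ letters ] ∑[ u ∈ vecsFrom letters m ] 𝟙 (avoids? v u) * (𝟙 (isInjective? u) * f (v ∷ u))
    ≡⟨ ∑-cong letters (λ v → ∑-vecsFrom-avoiding v m _) ⟩
  ∑[ v ∈ letters ] ∑[ σ ∈ words ] 𝟙 (isInjective? (Vec.map (punchIn v) σ)) * f (extend v σ)
    ≡⟨ ∑-cong letters (λ v → ∑-cong words (λ σ → cong (_* f (extend v σ)) (restrict v σ))) ⟩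
  ∑[ v ∈ letters ] ∑[ σ ∈ words ] 𝟙 (isInjective? σ) * f (extend v σ) ∎
  where
  letters : List (Fin (suc k))
  letters = allFin (suc k)
  words : List (Vec (Fin k) m)
  words = vecsFrom (allFin k) m
  split : ∀ v u → 𝟙 (isInjective? (v ∷ u)) * f (v ∷ u)
                ≡ 𝟙 (avoids? v u) * (𝟙 (isInjective? u) * f (v ∷ u))
  split v u = begin
    𝟙 (isInjective? (v ∷ u)) * f (v ∷ u)
      ≡⟨ cong (_* f (v ∷ u)) (𝟙-⇔ (isInjective-∷⇔ v u) (isInjective? (v ∷ u))
                                  (avoids? v u ×-dec isInjective? u)) ⟩
    𝟙 (avoids? v u ×-dec isInjective? u) * f (v ∷ u)
      ≡⟨ cong (_* f (v ∷ u)) (𝟙-×-dec (avoids? v u) (isInjective? u)) ⟩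
    𝟙 (avoids? v u) * 𝟙 (isInjective? u) * f (v ∷ u)
      ≡⟨ ℕ.*-assoc (𝟙 (avoids? v u)) _ _ ⟩
    𝟙 (avoids? v u) * (𝟙 (isInjective? u) * f (v ∷ u)) ∎
  restrict : ∀ v σ → 𝟙 (isInjective? (Vec.map (punchIn v) σ)) ≡ 𝟙 (isInjective? σ)
  restrict v σ =
    𝟙-⇔ (isInjective-map-punchIn⇔ v σ) (isInjective? (Vec.map (punchIn v) σ)) (isInjective? σ)

∑-perms-suc : (f : Vec (Fin (suc k)) (suc k) → ℕ) →
  ∑ (perms (suc k)) f ≡ ∑[ σ ∈ perms k ] ∑[ v ∈ allFin (suc k) ] f (extend v σ)
∑-perms-suc {k} f = begin
  ∑ (perms (suc k)) f
    ≡⟨ ∑-filter isInjective? (vecsFrom (allFin (suc k)) (suc k)) f ⟩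
  ∑[ u ∈ vecsFrom (allFin (suc k)) (suc k) ] 𝟙 (isInjective? u) * f u
    ≡⟨ ∑-injective-suc f ⟩
  ∑[ v ∈ allFin (suc k) ] ∑[ σ ∈ words ] 𝟙 (isInjective? σ) * f (extend v σ)
    ≡⟨ ∑-comm (allFin (suc k)) words _ ⟩
  ∑[ σ ∈ words ] ∑[ v ∈ allFin (suc k) ] 𝟙 (isInjective? σ) * f (extend v σ)
    ≡⟨ ∑-cong words (λ σ → *-distribˡ-∑ (𝟙 (isInjective? σ)) (allFin (suc k)) _) ⟨
  ∑[ σ ∈ words ] 𝟙 (isInjective? σ) * (∑[ v ∈ allFin (suc k) ] f (extend v σ))
    ≡⟨ ∑-filter isInjective? words _ ⟨
  ∑[ σ ∈ perms k ] ∑[ v ∈ allFin (suc k) ] f (extend v σ) ∎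
  where
  words : List (Vec (Fin k) k)
  words = vecsFrom (allFin k) k

extendAll : Vec (Fin (suc k)) t → Vec (Vec (Fin k) m) t → Vec (Vec (Fin (suc k)) (suc m)) t
extendAll = zipWith extend

∑-permTuples-suc : (t : ℕ) (f : Vec (Vec (Fin (suc k)) (suc k)) t → ℕ) →
  ∑ (vecsFrom (perms (suc k)) t) f
    ≡ ∑[ τ ∈ vecsFrom (perms k) t ] ∑[ vs ∈ vecsFrom (allFin (suc k)) t ] f (extendAll vs τ)
∑-permTuples-suc {k} = ∑-vecsFrom-zipWith extend (allFin (suc k)) (perms k) (perms (suc k)) ∑-perms-suc

-- Ascents of extended permutations

<punchIn⇔≤ : (i : Fin (suc k)) (j : Fin k) → i Fin.< punchIn i j ⇔ i Fin.≤ j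
<punchIn⇔≤ i j = mk⇔ (to i j) (from i j)
  where
  to : ∀ {k} (i : Fin (suc k)) (j : Fin k) → i Fin.< punchIn i j → i Fin.≤ j
  to zero    j       _        = z≤n
  to (suc i) (suc j) (s≤s i<) = s≤s (to i j i<)
  from : ∀ {k} (i : Fin (suc k)) (j : Fin k) → i Fin.≤ j → i Fin.< punchIn i j
  from zero    j       _        = s≤s z≤n
  from (suc i) (suc j) (s≤s i≤) = s≤s (from i j i≤)

punchIn-mono-< : (i : Fin (suc k)) (j l : Fin k) → j Fin.< l → punchIn i j Fin.< punchIn i l
punchIn-mono-< i j l j<l = ℕ.≰⇒> (λ il≤ij → ℕ.<⇒≱ j<l (Fin.punchIn-cancel-≤ i l j il≤ij))

punchIn-cancel-< : (i : Fin (suc k)) (j l : Fin k) → punchIn i j Fin.< punchIn i l → j Fin.< l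
punchIn-cancel-< i j l ij<il = ℕ.≰⇒> (λ l≤j → ℕ.<⇒≱ ij<il (Fin.punchIn-mono-≤ i l j l≤j))

isAscent-extend-zero⇔ : (v : Fin (suc (suc m))) (σ : Vec (Fin (suc m)) (suc m)) →
  IsAscent (extend v σ) zero ⇔ v Fin.≤ Vec.head σ
isAscent-extend-zero⇔ v (x ∷ σ) = <punchIn⇔≤ v x

isAscent-extend-suc⇔ : (v : Fin (suc (suc m))) (σ : Vec (Fin (suc m)) (suc m)) (j : Fin m) →
  IsAscent (extend v σ) (suc j) ⇔ IsAscent σ j
isAscent-extend-suc⇔ v σ j
  rewrite lookup-map (Fin.inject₁ j) (punchIn v) σ | lookup-map (suc j) (punchIn v) σ
  = mk⇔ (punchIn-cancel-< v _ _) (punchIn-mono-< v _ _)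

All-zipWith⁻ : {P : Z → Set} {Q : Y → Set} (g : X → Y → Z) → (∀ x y → P (g x y) → Q y) →
  (xs : Vec X t) (ys : Vec Y t) → All P (zipWith g xs ys) → All Q ys
All-zipWith⁻ g P⇒Q []       []       []       = []
All-zipWith⁻ g P⇒Q (x ∷ xs) (y ∷ ys) (p ∷ ps) = P⇒Q x y p ∷ All-zipWith⁻ g P⇒Q xs ys ps

All-zipWith⁺ : {P : Z → Set} {Q : Y → Set} (g : X → Y → Z) → (∀ x y → Q y → P (g x y)) →
  (xs : Vec X t) (ys : Vec Y t) → All Q ys → All P (zipWith g xs ys)
All-zipWith⁺ g Q⇒P []       []       []       = []
All-zipWith⁺ g Q⇒P (x ∷ xs) (y ∷ ys) (q ∷ qs) = Q⇒P x y q ∷ All-zipWith⁺ g Q⇒P xs ys qs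

CommonAscentAtZero : Vec (Vec (Fin (suc (suc m))) (suc (suc m))) t → Set
CommonAscentAtZero = All (λ σ → IsAscent σ zero)

commonAscentAtZero? : (τ : Vec (Vec (Fin (suc (suc m))) (suc (suc m))) t) → Dec (CommonAscentAtZero τ)
commonAscentAtZero? = all? (λ σ → isAscent? σ zero)

noCommonAscent-extendAll⇔ : (vs : Vec (Fin (suc (suc m))) t) (τ : Vec (Vec (Fin (suc m)) (suc m)) t) →
  NoCommonAscent (extendAll vs τ) ⇔ (NoCommonAscent τ × ¬ CommonAscentAtZero (extendAll vs τ))
noCommonAscent-extendAll⇔ vs τ = mk⇔
  (λ none → (λ (j , asc) → none (suc j , shiftUp j asc)) , (λ asc₀ → none (zero , asc₀)))
  λ where (none , ¬asc₀) (zero , asc₀) → ¬asc₀ asc₀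
          (none , ¬asc₀) (suc j , asc) → none (j , shiftDown j asc)
  where
  shiftUp : ∀ j → All (λ σ → IsAscent σ j) τ → All (λ σ → IsAscent σ (suc j)) (extendAll vs τ)
  shiftUp j = All-zipWith⁺ extend (λ v σ → Equivalence.from (isAscent-extend-suc⇔ v σ j)) vs τ
  shiftDown : ∀ j → All (λ σ → IsAscent σ (suc j)) (extendAll vs τ) → All (λ σ → IsAscent σ j) τ
  shiftDown j = All-zipWith⁻ extend (λ v σ → Equivalence.to (isAscent-extend-suc⇔ v σ j)) vs τ

𝟙-noCommonAscent-extendAll : (vs : Vec (Fin (suc (suc m))) t) (τ : Vec (Vec (Fin (suc m)) (suc m)) t) →
  𝟙 (noCommonAscent? (extendAll vs τ))
    ≡ 𝟙 (noCommonAscent? τ) * 𝟙 (¬? (commonAscentAtZero? (extendAll vs τ)))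
𝟙-noCommonAscent-extendAll vs τ = begin
  𝟙 (noCommonAscent? (extendAll vs τ))
    ≡⟨ 𝟙-⇔ (noCommonAscent-extendAll⇔ vs τ) (noCommonAscent? (extendAll vs τ)) (nca? ×-dec ¬asc₀?) ⟩
  𝟙 (nca? ×-dec ¬asc₀?)
    ≡⟨ 𝟙-×-dec nca? ¬asc₀? ⟩
  𝟙 nca? * 𝟙 ¬asc₀? ∎
  where
  nca? : Dec (NoCommonAscent τ)
  nca? = noCommonAscent? τ
  ¬asc₀? : Dec (¬ CommonAscentAtZero (extendAll vs τ))
  ¬asc₀? = ¬? (commonAscentAtZero? (extendAll vs τ))

-- Binomial weights

∑-allFin-≤ : (N p : ℕ) (f : ℕ → ℕ) → p < N →
  ∑[ x ∈ allFin N ] 𝟙 (toℕ x ℕ.≤? p) * f (toℕ x) ≡ ∑[ x ∈ allFin (suc p) ] f (toℕ x)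
∑-allFin-≤ (suc N) zero f _ = begin
  ∑[ x ∈ allFin (suc N) ] 𝟙 (toℕ x ℕ.≤? 0) * f (toℕ x)
    ≡⟨ ∑-allFin-suc N (λ x → 𝟙 (toℕ x ℕ.≤? 0) * f (toℕ x)) ⟩
  1 * f 0 + ∑[ x ∈ allFin N ] 0
    ≡⟨ cong₂ _+_ (ℕ.*-identityˡ (f 0)) (∑-0 (allFin N)) ⟩
  f 0 + 0 ∎
∑-allFin-≤ (suc N) (suc p) f p<N = begin
  ∑[ x ∈ allFin (suc N) ] 𝟙 (toℕ x ℕ.≤? suc p) * f (toℕ x)
    ≡⟨ ∑-allFin-suc N (λ x → 𝟙 (toℕ x ℕ.≤? suc p) * f (toℕ x)) ⟩
  1 * f 0 + ∑[ x ∈ allFin N ] 𝟙 (suc (toℕ x) ℕ.≤? suc p) * f (suc (toℕ x))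
    ≡⟨ cong₂ _+_ (ℕ.*-identityˡ (f 0))
                 (∑-cong (allFin N) (λ x → cong (_* f (suc (toℕ x))) (≤?-suc x))) ⟩
  f 0 + ∑[ x ∈ allFin N ] 𝟙 (toℕ x ℕ.≤? p) * f (suc (toℕ x))
    ≡⟨ cong (f 0 +_) (∑-allFin-≤ N p (f ∘ suc) (s≤s⁻¹ p<N)) ⟩
  f 0 + ∑[ x ∈ allFin (suc p) ] f (suc (toℕ x))
    ≡⟨ ∑-allFin-suc (suc p) (f ∘ toℕ) ⟨
  ∑[ x ∈ allFin (suc (suc p)) ] f (toℕ x) ∎
  where
  ≤?-suc : (x : Fin N) → 𝟙 (suc (toℕ x) ℕ.≤? suc p) ≡ 𝟙 (toℕ x ℕ.≤? p)
  ≤?-suc x = 𝟙-⇔ (mk⇔ s≤s⁻¹ s≤s) (suc (toℕ x) ℕ.≤? suc p) (toℕ x ℕ.≤? p)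

hockey-stick-from : (a c N : ℕ) → ∑[ x ∈ allFin N ] (a + toℕ x) C c + a C suc c ≡ (a + N) C suc c
hockey-stick-from a c zero    = cong (_C suc c) (sym (ℕ.+-identityʳ a))
hockey-stick-from a c (suc N) = begin
  ∑[ x ∈ allFin (suc N) ] (a + toℕ x) C c + a C suc c
    ≡⟨ cong (_+ a C suc c) (∑-allFin-suc N (λ x → (a + toℕ x) C c)) ⟩
  (a + 0) C c + ∑[ x ∈ allFin N ] (a + suc (toℕ x)) C c + a C suc c
    ≡⟨ cong₂ (λ b S → b C c + S + a C suc c) (ℕ.+-identityʳ a)
         (∑-cong (allFin N) (λ x → cong (_C c) (ℕ.+-suc a (toℕ x)))) ⟩
  a C c + S + a C suc c
    ≡⟨ +-CS.xy∙z≈y∙xz (a C c) S (a C suc c) ⟩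
  S + (a C c + a C suc c)
    ≡⟨ cong (S +_) (nCk+nC[k+1]≡[n+1]C[k+1] a c) ⟩
  S + suc a C suc c
    ≡⟨ hockey-stick-from (suc a) c N ⟩
  (suc a + N) C suc c
    ≡⟨ cong (_C suc c) (ℕ.+-suc a N) ⟨
  (a + suc N) C suc c ∎
  where
  S : ℕ
  S = ∑[ x ∈ allFin N ] (suc a + toℕ x) C c

hockey-stick : (c N : ℕ) → ∑[ x ∈ allFin N ] (c + toℕ x) C c ≡ (c + N) C suc c
hockey-stick c N = begin
  S             ≡⟨ ℕ.+-identityʳ S ⟨
  S + 0         ≡⟨ cong (S +_) (k>n⇒nCk≡0 (ℕ.n<1+n c)) ⟨
  S + c C suc c ≡⟨ hockey-stick-from c c N ⟩
  (c + N) C suc c ∎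
  where
  S : ℕ
  S = ∑[ x ∈ allFin N ] (c + toℕ x) C c

module _ (n : ℕ) where

  weight : ℕ → ℕ → ℕ
  weight K i = (n ∸ K + i) C (n ∸ K)

  weight-zero : (K : ℕ) → weight K 0 ≡ 1
  weight-zero K = trans (cong (_C (n ∸ K)) (ℕ.+-identityʳ (n ∸ K))) (nCn≡1 (n ∸ K))

  weight-top : (i : ℕ) → weight n i ≡ 1
  weight-top i = cong (λ c → (c + i) C c) (ℕ.n∸n≡0 n)

  private
    suc[n∸suc[k]]≡n∸k : suc k ≤ n → suc (n ∸ suc k) ≡ n ∸ k
    suc[n∸suc[k]]≡n∸k le = sym (ℕ.+-∸-assoc 1 le)

  ∑-weight-≤ : suc k ≤ n → (p : ℕ) → p ≤ k →
    ∑[ v ∈ allFin (suc k) ] 𝟙 (toℕ v ℕ.≤? p) * weight (suc k) (toℕ v) ≡ weight k p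
  ∑-weight-≤ {k} le p p≤k = begin
    ∑[ v ∈ allFin (suc k) ] 𝟙 (toℕ v ℕ.≤? p) * weight (suc k) (toℕ v)
      ≡⟨ ∑-allFin-≤ (suc k) p (weight (suc k)) (s≤s p≤k) ⟩
    ∑[ v ∈ allFin (suc p) ] weight (suc k) (toℕ v)
      ≡⟨ hockey-stick c (suc p) ⟩
    (c + suc p) C suc c
      ≡⟨ cong (_C suc c) (ℕ.+-suc c p) ⟩
    (suc c + p) C suc c
      ≡⟨ cong (λ b → (b + p) C b) (suc[n∸suc[k]]≡n∸k le) ⟩
    weight k p ∎
    where
    c : ℕ
    c = n ∸ suc k

  ∑-weight : suc k ≤ n → ∑[ v ∈ allFin (suc k) ] weight (suc k) (toℕ v) ≡ n C k
  ∑-weight {k} le = begin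
    ∑[ v ∈ allFin (suc k) ] weight (suc k) (toℕ v)
      ≡⟨ hockey-stick c (suc k) ⟩
    (c + suc k) C suc c
      ≡⟨ cong₂ _C_ (ℕ.m∸n+n≡m le) (suc[n∸suc[k]]≡n∸k le) ⟩
    n C (n ∸ k)
      ≡⟨ nCk≡nC[n∸k] (ℕ.<⇒≤ le) ⟨
    n C k ∎
    where
    c : ℕ
    c = n ∸ suc k

-- Weighted counts of tuples with no common ascent

w≡∑𝟙 : (t m : ℕ) → w t (suc m) ≡ ∑[ τ ∈ vecsFrom (perms (suc m)) t ] 𝟙 (noCommonAscent? τ)
w≡∑𝟙 t m = length-filter noCommonAscent? (vecsFrom (perms (suc m)) t)

w-one : (t : ℕ) → w t 1 ≡ 1
w-one t = begin
  w t 1                                                 ≡⟨ w≡∑𝟙 t 0 ⟩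
  ∑[ τ ∈ vecsFrom (perms 1) t ] 𝟙 (noCommonAscent? τ)    ≡⟨ ∑-vecsFrom-singleton (zero ∷ []) t _ ⟩
  𝟙 (noCommonAscent? τ₀)                                ≡⟨ 𝟙-yes (λ ()) (noCommonAscent? τ₀) ⟩
  1                                                     ∎
  where
  τ₀ : Vec (Vec (Fin 1) 1) t
  τ₀ = Vec.replicate t (zero ∷ [])

module _ (t n : ℕ) where

  PermTuple : ℕ → Set
  PermTuple m = Vec (Vec (Fin (suc m)) (suc m)) t

  permTuples : (m : ℕ) → List (PermTuple m)
  permTuples m = vecsFrom (perms (suc m)) t

  tupleWeight : ℕ → PermTuple m → ℕ
  tupleWeight K τ = ∏[ σ ∈ τ ] weight n K (toℕ (Vec.head σ))

  E : ℕ → ℕ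
  E m = ∑[ τ ∈ permTuples m ] 𝟙 (noCommonAscent? τ) * tupleWeight (suc m) τ

  extensionSum : PermTuple m → (PermTuple (suc m) → ℕ) → ℕ
  extensionSum {m} τ f = ∑[ vs ∈ vecsFrom (allFin (suc (suc m))) t ] f (extendAll vs τ)

  ascent₀Weight noAscent₀Weight : PermTuple (suc m) → ℕ
  ascent₀Weight   {m} τ = 𝟙 (commonAscentAtZero? τ) * tupleWeight (suc (suc m)) τ
  noAscent₀Weight {m} τ = 𝟙 (¬? (commonAscentAtZero? τ)) * tupleWeight (suc (suc m)) τ

  E-unitWeight : (∀ (p : Fin (suc m)) → weight n (suc m) (toℕ p) ≡ 1) → E m ≡ w t (suc m)
  E-unitWeight {m} unit = begin
    E m
      ≡⟨ ∑-cong (permTuples m) (λ τ → cong (𝟙 (noCommonAscent? τ) *_) (unitTuple τ)) ⟩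
    ∑[ τ ∈ permTuples m ] 𝟙 (noCommonAscent? τ) * 1
      ≡⟨ ∑-cong (permTuples m) (λ τ → ℕ.*-identityʳ (𝟙 (noCommonAscent? τ))) ⟩
    ∑[ τ ∈ permTuples m ] 𝟙 (noCommonAscent? τ)
      ≡⟨ w≡∑𝟙 t m ⟨
    w t (suc m) ∎
    where
    unitTuple : (τ : PermTuple m) → tupleWeight (suc m) τ ≡ 1
    unitTuple τ = trans (∏-cong τ (unit ∘ Vec.head)) (trans (∏-const τ 1) (ℕ.^-zeroˡ t))

  E-zero : E 0 ≡ 1
  E-zero = trans (E-unitWeight (λ { zero → weight-zero n 1 })) (w-one t)

  E-last : suc m ≡ n → E m ≡ w t (suc m)
  E-last refl = E-unitWeight (weight-top n ∘ toℕ)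

  E-suc : (m : ℕ) →
    E (suc m) ≡ ∑[ τ ∈ permTuples m ] 𝟙 (noCommonAscent? τ) * extensionSum τ noAscent₀Weight
  E-suc m = begin
    E (suc m)
      ≡⟨ ∑-permTuples-suc t _ ⟩
    ∑[ τ ∈ permTuples m ] extensionSum τ (λ τ′ → 𝟙 (noCommonAscent? τ′) * tupleWeight (suc (suc m)) τ′)
      ≡⟨ ∑-cong (permTuples m) (λ τ → ∑-cong firstLetters (λ vs → split vs τ)) ⟩
    ∑[ τ ∈ permTuples m ] ∑[ vs ∈ firstLetters ] 𝟙 (noCommonAscent? τ) * noAscent₀Weight (extendAll vs τ)
      ≡⟨ ∑-cong (permTuples m) (λ τ → *-distribˡ-∑ (𝟙 (noCommonAscent? τ)) firstLetters _) ⟨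
    ∑[ τ ∈ permTuples m ] 𝟙 (noCommonAscent? τ) * extensionSum τ noAscent₀Weight ∎
    where
    firstLetters : List (Vec (Fin (suc (suc m))) t)
    firstLetters = vecsFrom (allFin (suc (suc m))) t
    split : ∀ vs τ → 𝟙 (noCommonAscent? (extendAll vs τ)) * tupleWeight (suc (suc m)) (extendAll vs τ)
                   ≡ 𝟙 (noCommonAscent? τ) * noAscent₀Weight (extendAll vs τ)
    split vs τ =
      trans (cong (_* tupleWeight (suc (suc m)) (extendAll vs τ)) (𝟙-noCommonAscent-extendAll vs τ))
            (ℕ.*-assoc (𝟙 (noCommonAscent? τ)) _ _)

  module _ {m : ℕ} (le : suc (suc m) ≤ n) where

    ∑-weight-ascent₀ : (σ : Vec (Fin (suc m)) (suc m)) →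
      ∑[ v ∈ allFin (suc (suc m)) ] 𝟙 (isAscent? (extend v σ) zero) * weight n (suc (suc m)) (toℕ v)
        ≡ weight n (suc m) (toℕ (Vec.head σ))
    ∑-weight-ascent₀ σ = begin
      ∑[ v ∈ allFin (suc (suc m)) ] 𝟙 (isAscent? (extend v σ) zero) * weight n (suc (suc m)) (toℕ v)
        ≡⟨ ∑-cong (allFin (suc (suc m))) (λ v → cong (_* weight n (suc (suc m)) (toℕ v)) (ascent₀⇔≤ v)) ⟩
      ∑[ v ∈ allFin (suc (suc m)) ] 𝟙 (toℕ v ℕ.≤? toℕ (Vec.head σ)) * weight n (suc (suc m)) (toℕ v)
        ≡⟨ ∑-weight-≤ n le (toℕ (Vec.head σ)) (ℕ.<⇒≤ (Fin.toℕ<n (Vec.head σ))) ⟩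
      weight n (suc m) (toℕ (Vec.head σ)) ∎
      where
      ascent₀⇔≤ : ∀ v → 𝟙 (isAscent? (extend v σ) zero) ≡ 𝟙 (toℕ v ℕ.≤? toℕ (Vec.head σ))
      ascent₀⇔≤ v =
        𝟙-⇔ (isAscent-extend-zero⇔ v σ) (isAscent? (extend v σ) zero) (toℕ v ℕ.≤? toℕ (Vec.head σ))

    tupleWeight≡extensionSum : (τ : PermTuple m) → tupleWeight (suc m) τ ≡ extensionSum τ ascent₀Weight
    tupleWeight≡extensionSum τ = begin
      tupleWeight (suc m) τ
        ≡⟨ ∏-cong τ ∑-weight-ascent₀ ⟨
      ∏[ σ ∈ τ ] ∑[ v ∈ allFin (suc (suc m)) ] ascent₀w (extend v σ)
        ≡⟨ ∑-vecsFrom-∏ extend (allFin (suc (suc m))) τ ascent₀w ⟨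
      extensionSum τ (λ τ′ → ∏[ σ ∈ τ′ ] ascent₀w σ)
        ≡⟨ ∑-cong (vecsFrom (allFin (suc (suc m))) t)
             (λ vs → 𝟙-all?*∏ (λ σ → isAscent? σ zero) (extendAll vs τ) _) ⟨
      extensionSum τ ascent₀Weight ∎
      where
      ascent₀w : Vec (Fin (suc (suc m))) (suc (suc m)) → ℕ
      ascent₀w σ = 𝟙 (isAscent? σ zero) * weight n (suc (suc m)) (toℕ (Vec.head σ))

    extensionSum-tupleWeight : (τ : PermTuple m) →
      extensionSum τ (tupleWeight (suc (suc m))) ≡ (n C suc m) ^ t
    extensionSum-tupleWeight τ = begin
      extensionSum τ (tupleWeight (suc (suc m)))
        ≡⟨ ∑-vecsFrom-∏ extend (allFin (suc (suc m))) τ (weight n (suc (suc m)) ∘ toℕ ∘ Vec.head) ⟩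
      ∏[ σ ∈ τ ] ∑[ v ∈ allFin (suc (suc m)) ] weight n (suc (suc m)) (toℕ v)
        ≡⟨ ∏-cong τ (λ _ → ∑-weight n le) ⟩
      ∏[ σ ∈ τ ] n C suc m
        ≡⟨ ∏-const τ (n C suc m) ⟩
      (n C suc m) ^ t ∎

    extensionSum-noAscent₀+tupleWeight : (τ : PermTuple m) →
      extensionSum τ noAscent₀Weight + tupleWeight (suc m) τ ≡ (n C suc m) ^ t
    extensionSum-noAscent₀+tupleWeight τ = begin
      extensionSum τ noAscent₀Weight + tupleWeight (suc m) τ
        ≡⟨ cong (extensionSum τ noAscent₀Weight +_) (tupleWeight≡extensionSum τ) ⟩
      extensionSum τ noAscent₀Weight + extensionSum τ ascent₀Weight
        ≡⟨ ∑-distrib-+ (vecsFrom (allFin (suc (suc m))) t) _ _ ⟨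
      extensionSum τ (λ τ′ → noAscent₀Weight τ′ + ascent₀Weight τ′)
        ≡⟨ ∑-cong (vecsFrom (allFin (suc (suc m))) t) (λ vs →
             𝟙-¬?+𝟙 (commonAscentAtZero? (extendAll vs τ)) (tupleWeight (suc (suc m)) (extendAll vs τ))) ⟩
      extensionSum τ (tupleWeight (suc (suc m)))
        ≡⟨ extensionSum-tupleWeight τ ⟩
      (n C suc m) ^ t ∎

    E-suc+E : E (suc m) + E m ≡ w t (suc m) * (n C suc m) ^ t
    E-suc+E = begin
      E (suc m) + E m
        ≡⟨ cong (_+ E m) (E-suc m) ⟩
      ∑[ τ ∈ permTuples m ] 𝟙 (noCommonAscent? τ) * extensionSum τ noAscent₀Weight
        + ∑[ τ ∈ permTuples m ] 𝟙 (noCommonAscent? τ) * tupleWeight (suc m) τ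
        ≡⟨ ∑-distrib-+ (permTuples m) _ _ ⟨
      ∑[ τ ∈ permTuples m ] (𝟙 (noCommonAscent? τ) * extensionSum τ noAscent₀Weight
                             + 𝟙 (noCommonAscent? τ) * tupleWeight (suc m) τ)
        ≡⟨ ∑-cong (permTuples m) (λ τ → trans (sym (ℕ.*-distribˡ-+ (𝟙 (noCommonAscent? τ)) _ _))
             (cong (𝟙 (noCommonAscent? τ) *_) (extensionSum-noAscent₀+tupleWeight τ))) ⟩
      ∑[ τ ∈ permTuples m ] 𝟙 (noCommonAscent? τ) * (n C suc m) ^ t
        ≡⟨ *-distribʳ-∑ ((n C suc m) ^ t) (permTuples m) _ ⟨
      (∑[ τ ∈ permTuples m ] 𝟙 (noCommonAscent? τ)) * (n C suc m) ^ t
        ≡⟨ cong (_* (n C suc m) ^ t) (w≡∑𝟙 t m) ⟨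
      w t (suc m) * (n C suc m) ^ t ∎

-- The alternating sum

-- Opened only here: `+_` would make the sections `(x +_)` of ℕ ambiguous above.
open import Data.Integer using (+_)

term : (t n i : ℕ) → ℕ
term t n i = w t i * (n C i) ^ t

partialAltSum : (t n k i : ℕ) → ℤ
partialAltSum t n k zero    = sign k ℤ.* + term t n 0
partialAltSum t n k (suc i) = partialAltSum t n k i ℤ.+ sign (k ∸ suc i) ℤ.* + term t n (suc i)

-- `altSum` accumulates with a `where`-bound function of Defs, which cannot be
-- named here and which `partialAltSum` copies.  The left-hand sides of the two
-- helpers are therefore left to unification with their uses; abstracting `ℤ._+_`
-- and `suc k` keeps those unification problems in pattern form.
mutual
  altSum≡partialAltSum : (t n k : ℕ) → altSum t n k ≡ partialAltSum t n k k
  altSum≡partialAltSum t n zero    = refl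
  altSum≡partialAltSum t n (suc k) with ℤ._+_
  ... | plus = cong₂ plus (lastAccumulator≡ t n k) refl

  lastAccumulator≡ : (t n k : ℕ) → _ ≡ partialAltSum t n (suc k) k
  lastAccumulator≡ t n k with suc k
  ... | K = accumulator≡ t n K k

  accumulator≡ : (t n K i : ℕ) → _ ≡ partialAltSum t n K i
  accumulator≡ t n K zero    = refl
  accumulator≡ t n K (suc i) =
    cong (ℤ._+ sign (K ∸ suc i) ℤ.* + term t n (suc i)) (accumulator≡ t n K i)

partialAltSum-suc-neg : (t n : ℕ) {k i : ℕ} → i ≤ k →
  partialAltSum t n (suc k) i ≡ ℤ.- partialAltSum t n k i
partialAltSum-suc-neg t n {k} {zero}  _   = sym (ℤ.neg-distribˡ-* (sign k) (+ term t n 0))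
partialAltSum-suc-neg t n {k} {suc i} i<k = begin
  partialAltSum t n (suc k) i ℤ.+ sign (k ∸ i) ℤ.* x
    ≡⟨ cong₂ (λ p e → p ℤ.+ sign e ℤ.* x) (partialAltSum-suc-neg t n (ℕ.<⇒≤ i<k)) (ℕ.+-∸-assoc 1 i<k) ⟩
  ℤ.- P ℤ.+ ℤ.- s ℤ.* x
    ≡⟨ cong (ℤ._+_ (ℤ.- P)) (ℤ.neg-distribˡ-* s x) ⟨
  ℤ.- P ℤ.+ ℤ.- (s ℤ.* x)
    ≡⟨ ℤ.neg-distrib-+ P (s ℤ.* x) ⟨
  ℤ.- (P ℤ.+ s ℤ.* x) ∎
  where
  x s P : ℤ
  x = + term t n (suc i)
  s = sign (k ∸ suc i)
  P = partialAltSum t n k i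

altSum-suc : (t n k : ℕ) → altSum t n (suc k) ≡ + term t n (suc k) ℤ.- altSum t n k
altSum-suc t n k = begin
  altSum t n (suc k)
    ≡⟨ altSum≡partialAltSum t n (suc k) ⟩
  partialAltSum t n (suc k) k ℤ.+ sign (k ∸ k) ℤ.* x
    ≡⟨ cong₂ (λ p e → p ℤ.+ sign e ℤ.* x) (partialAltSum-suc-neg t n (ℕ.≤-refl {k})) (ℕ.n∸n≡0 k) ⟩
  ℤ.- P ℤ.+ + 1 ℤ.* x
    ≡⟨ cong (ℤ._+_ (ℤ.- P)) (ℤ.*-identityˡ x) ⟩
  ℤ.- P ℤ.+ x
    ≡⟨ ℤ.+-comm (ℤ.- P) x ⟩
  x ℤ.- P
    ≡⟨ cong (ℤ._-_ x) (altSum≡partialAltSum t n k) ⟨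
  x ℤ.- altSum t n k ∎
  where
  x P : ℤ
  x = + term t n (suc k)
  P = partialAltSum t n k k

altSum≡E : (t n k : ℕ) → k < n → altSum t n k ≡ + E t n k
altSum≡E t n zero    _   = begin
  altSum t n 0  ≡⟨ ℤ.*-identityˡ (+ term t n 0) ⟩
  + (1 * 1 ^ t) ≡⟨ cong +_ (trans (ℕ.*-identityˡ (1 ^ t)) (ℕ.^-zeroˡ t)) ⟩
  + 1           ≡⟨ cong +_ (E-zero t n) ⟨
  + E t n 0     ∎
altSum≡E t n (suc k) k<n = begin
  altSum t n (suc k)
    ≡⟨ altSum-suc t n k ⟩
  + term t n (suc k) ℤ.- altSum t n k
    ≡⟨ cong₂ (λ a s → + a ℤ.- s) (E-suc+E t n k<n) (sym (altSum≡E t n k (ℕ.<⇒≤ k<n))) ⟨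
  + (E t n (suc k) + E t n k) ℤ.- + E t n k
    ≡⟨ cong (ℤ._- + E t n k) (ℤ.pos-+ (E t n (suc k)) (E t n k)) ⟩
  + E t n (suc k) ℤ.+ + E t n k ℤ.- + E t n k
    ≡⟨ //-rightDividesʳ (+ E t n k) (+ E t n (suc k)) ⟩
  + E t n (suc k) ∎

altSum-last : (t n : ℕ) → 1 ≤ n → altSum t n n ≡ + 0
altSum-last t (suc m) _ = begin
  altSum t (suc m) (suc m)
    ≡⟨ altSum-suc t (suc m) m ⟩
  + term t (suc m) (suc m) ℤ.- altSum t (suc m) m
    ≡⟨ cong₂ (λ a s → + a ℤ.- s) term-last (altSum≡E t (suc m) m ℕ.≤-refl) ⟩
  + w t (suc m) ℤ.- + E t (suc m) m
    ≡⟨ cong (λ e → + w t (suc m) ℤ.- + e) (E-last t (suc m) refl) ⟩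
  + w t (suc m) ℤ.- + w t (suc m)
    ≡⟨ ℤ.+-inverseʳ (+ w t (suc m)) ⟩
  + 0 ∎
  where
  term-last : term t (suc m) (suc m) ≡ w t (suc m)
  term-last = begin
    w t (suc m) * (suc m C suc m) ^ t ≡⟨ cong (λ b → w t (suc m) * b ^ t) (nCn≡1 (suc m)) ⟩
    w t (suc m) * 1 ^ t               ≡⟨ cong (w t (suc m) *_) (ℕ.^-zeroˡ t) ⟩
    w t (suc m) * 1                   ≡⟨ ℕ.*-identityʳ (w t (suc m)) ⟩
    w t (suc m)                       ∎

proposition5p2 : (t n k : ℕ) → 1 ≤ t → 1 ≤ n → 1 ≤ k → k ≤ n →
    + 0 ℤ.≤ altSum t n k
proposition5p2 t n k _ 1≤n _ k≤n with ℕ.m≤n⇒m<n∨m≡n k≤n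
... | inj₁ k<n  = subst (+ 0 ℤ.≤_) (sym (altSum≡E t n k k<n)) (ℤ.+≤+ z≤n)
... | inj₂ refl = ℤ.≤-reflexive (sym (altSum-last t n 1≤n))
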